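{- Let $T$ be a tree and $x$ an eigenvector of $T$ for eigenvalue $\lambda$. Then every connected component of $T\setminus N(T,x)$ is also a connected component of $T\setminus N_\lambda(T)$, i.e. $\mathfrak{C}(T\setminus N(T,x))\subseteq \mathfrak{C}(T\setminus N_\lambda(T))$.
   Context: Eigenvalues and eigenvectors of a graph are those of its adjacency matrix; an eigenvector for $\lambda$ is a non-zero vector $x$ with $Ax=\lambda x$. $N(T,x)$ is the set of vertices on which $x$ vanishes; $N_\lambda(T)$ is the set of vertices on which every eigenvector of $T$ for $\lambda$ vanishes. For $M\subseteq V(G)$, $G\setminus M$ is obtained by deleting the vertices of $M$, and $\mathfrak{C}(G)$ denotes the set of connected components of $G$ (as subgraphs). -}

module Defs where

open import Level using (0ℓ)
open import Data.Nat using (ℕ; zero; suc; _≤_)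
open import Data.Fin using (Fin; zero; suc)
open import Data.Bool using (Bool; true; false)
open import Data.List using (List; []; _∷_; length; last)
open import Data.Maybe using (just)
open import Data.List.Relation.Unary.Unique.Propositional using (Unique)
open import Data.Product using (Σ; ∃; _×_; _,_)
open import Relation.Nullary using (¬_)
open import Relation.Binary.PropositionalEquality using (_≡_)
open import Relation.Binary.Structures using (IsTotalOrder)
open import Algebra.Bundles using (CommutativeRing)

-- The real numbers, axiomatised as a Dedekind-complete ordered field
-- (unique up to isomorphism); the theorem is quantified over any model.

record RealField : Set₁ where
  field
    commRing : CommutativeRing 0ℓ 0ℓ
  open CommutativeRing commRing public
  field
    _≤ℝ_         : Carrier → Carrier → Set
    isTotalOrder : IsTotalOrder _≈_ _≤ℝ_
    nontrivial   : ¬ (1# ≈ 0#)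
    inverse      : ∀ x → ¬ (x ≈ 0#) → ∃ λ y → (x * y) ≈ 1#
    +-mono       : ∀ x y z → x ≤ℝ y → (x + z) ≤ℝ (y + z)
    *-nonneg     : ∀ x y → 0# ≤ℝ x → 0# ≤ℝ y → 0# ≤ℝ (x * y)
    complete     : (P : Carrier → Set) → (∃ λ x → P x) →
                   (∃ λ b → ∀ x → P x → x ≤ℝ b) →
                   ∃ λ s → (∀ x → P x → x ≤ℝ s) ×
                           (∀ b → (∀ x → P x → x ≤ℝ b) → s ≤ℝ b)

record Graph (n : ℕ) : Set where
  field
    adj     : Fin n → Fin n → Bool
    adj-sym : ∀ u v → adj u v ≡ adj v u
    adj-irr : ∀ v → adj v v ≡ false
open Graph public

Adj : ∀ {n} → Graph n → Fin n → Fin n → Set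
Adj G u v = adj G u v ≡ true

data Walk {n : ℕ} (G : Graph n) (W : Fin n → Set) : Fin n → Fin n → Set where
  stay : ∀ {v} → W v → Walk G W v v
  step : ∀ {u w v} → W u → Adj G u w → Walk G W w v → Walk G W u v

Everywhere : ∀ {n} → Fin n → Set
Everywhere _ = Data.Unit.⊤
  where import Data.Unit

Connected : ∀ {n} → Graph n → Set
Connected G = ∀ u v → Walk G Everywhere u v

Path : ∀ {n} → Graph n → List (Fin n) → Set
Path G []           = Data.Unit.⊤ where import Data.Unit
Path G (u ∷ [])     = Data.Unit.⊤ where import Data.Unit
Path G (u ∷ w ∷ vs) = Adj G u w × Path G (w ∷ vs)

IsCycle : ∀ {n} → Graph n → List (Fin n) → Set
IsCycle G []       = Data.Empty.⊥ where import Data.Empty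
IsCycle G (v ∷ vs) =
  3 ≤ length (v ∷ vs) × Unique (v ∷ vs) × Path G (v ∷ vs) ×
  (∃ λ w → last (v ∷ vs) ≡ just w × Adj G w v)

Acyclic : ∀ {n} → Graph n → Set
Acyclic G = ∀ cs → ¬ IsCycle G cs

IsTree : ∀ {n} → Graph n → Set
IsTree {n} G = (1 ≤ n) × Connected G × Acyclic G

-- A
-- component is an induced subgraph, hence determined by its vertex set S:
-- S is non-empty, avoids M, is connected in G ∖ M, and is closed under
-- adjacency in G ∖ M.

IsComponentOfDel : ∀ {n} → Graph n → (Fin n → Set) → (Fin n → Set) → Set
IsComponentOfDel G M S =
  (∃ λ v → S v) ×
  (∀ v → S v → ¬ M v) ×
  (∀ u v → S u → S v → Walk G (λ w → ¬ M w) u v) ×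
  (∀ u v → S u → ¬ M v → Adj G u v → S v)

module Spectral (ℝ : RealField) where
  open RealField ℝ using (Carrier; _≈_; _+_; _*_; 0#; 1#)

  Σ[_] : ∀ {n} → (Fin n → Carrier) → Carrier
  Σ[_] {zero}  f = 0#
  Σ[_] {suc n} f = f zero + Σ[_] (λ i → f (suc i))

  A : ∀ {n} → Graph n → Fin n → Fin n → Carrier
  A G u v with adj G u v
  ... | true  = 1#
  ... | false = 0#

  Mul : ∀ {n} → Graph n → (Fin n → Carrier) → Fin n → Carrier
  Mul G x u = Σ[ (λ v → A G u v * x v) ]

  IsEigenvector : ∀ {n} → Graph n → Carrier → (Fin n → Carrier) → Set
  IsEigenvector G λ' x = (∃ λ v → ¬ (x v ≈ 0#)) × (∀ u → Mul G x u ≈ λ' * x u)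

  N : ∀ {n} → Graph n → (Fin n → Carrier) → Fin n → Set
  N G x v = x v ≈ 0#

  Nλ : ∀ {n} → Graph n → Carrier → Fin n → Set
  Nλ G λ' v = ∀ y → IsEigenvector G λ' y → y v ≈ 0#

-- Let S be a component of T ∖ N(T,x). Every vertex of N_λ(T) lies in N(T,x),
-- so it suffices that each v ∈ N(T,x) adjacent to some u ∈ S lies in N_λ(T).
-- Restrict x to the branch of T at v containing u. Since T is a tree, u is
-- the only neighbour of v in that branch, so the restriction z satisfies
-- (Az)_b = λ z_b for b ≠ v and (Az)_v = x_u. For any eigenvector y, symmetry
-- of A gives ⟨y, Az⟩ = ⟨Ay, z⟩ = λ ⟨y, z⟩, whence y_v x_u = 0 and so y_v = 0.

module Submission where

open import Defs
open import Level using (Level)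
open import Data.Bool using (true; false; if_then_else_)
import Data.Bool.Properties as Bool
open import Data.Nat using (ℕ; zero; suc; _≤_; z≤n; s≤s)
open import Data.Nat.Properties using (≤-trans; 1+n≰n)
open import Data.Nat.GeneralisedArithmetic using (fold)
open import Data.Fin using (Fin; zero; suc; punchIn)
open import Data.Fin.Properties using (_≟_; any?; punchInᵢ≢i)
open import Data.Fin.Subset using (Subset; _∈_; _∉_; _⊆_; _⊂_; _∪_; ⁅_⁆; ∣_∣)
open import Data.Fin.Subset.Properties
  using (_∈?_; ⊆-antisym; p⊂q⇒∣p∣<∣q∣; ∣p∣≤n; p⊆p∪q; x∈p∪q⁺; x∈p∪q⁻; x∈⁅x⁆; x∈⁅y⁆⇒x≡y; x≢y⇒x∉⁅y⁆)
open import Data.Vec using ([]; _∷_; here; there)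
open import Data.List using ([]; _∷_; last)
open import Data.Maybe using (just)
open import Data.Maybe.Properties using (just-injective)
open import Data.List.Relation.Unary.All as All using (All; []; _∷_)
import Data.List.Relation.Unary.AllPairs as AllPairs
open import Data.List.Relation.Unary.Unique.Propositional using (Unique)
open import Data.Product using (∃; _×_; _,_; proj₁)
open import Data.Sum using (_⊎_; inj₁; inj₂)
open import Data.Empty using (⊥-elim)
open import Data.Unit using (tt)
open import Function using (_∘_)
open import Relation.Nullary using (¬_; yes; no; does; contradiction)
open import Relation.Nullary.Decidable using (_×-dec_; ¬?)
open import Relation.Unary using (Pred; Decidable)
import Relation.Binary.PropositionalEquality as P
open P using (_≡_; _≢_)
import Algebra.Properties.CommutativeSemigroup as CommSemigroupProperties
import Algebra.Properties.Group as GroupProperties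
import Algebra.Properties.Loop as LoopProperties
import Algebra.Properties.Semiring.Sum as SemiringSum

private variable ℓ : Level

satisfying : ∀ {n} {P : Pred (Fin n) ℓ} → Decidable P → Subset n
satisfying {n = zero}  P? = []
satisfying {n = suc n} P? = does (P? zero) ∷ satisfying (P? ∘ suc)

satisfying⁺ : ∀ {n} {P : Pred (Fin n) ℓ} (P? : Decidable P) {w} → P w → w ∈ satisfying P?
satisfying⁺ P? {w = zero} p with P? zero
... | yes _  = here
... | no ¬p = contradiction p ¬p
satisfying⁺ P? {w = suc w} p = there (satisfying⁺ (P? ∘ suc) p)

satisfying⁻ : ∀ {n} {P : Pred (Fin n) ℓ} (P? : Decidable P) {w} → w ∈ satisfying P? → P w
satisfying⁻ P? {w = zero} w∈ with P? zero | w∈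
... | yes p | _ = p
... | no _  | ()
satisfying⁻ P? {w = suc w} (there w∈) = satisfying⁻ (P? ∘ suc) w∈

⊆⇒≡⊎⊂ : ∀ {n} {p q : Subset n} → p ⊆ q → p ≡ q ⊎ p ⊂ q
⊆⇒≡⊎⊂ {p = p} {q} p⊆q with any? (λ w → (w ∈? q) ×-dec ¬? (w ∈? p))
... | yes (w , w∈q , w∉p) = inj₂ (p⊆q , w , w∈q , w∉p)
... | no noNew = inj₁ (⊆-antisym p⊆q q⊆p)
  where
  q⊆p : q ⊆ p
  q⊆p {w} w∈q with w ∈? p
  ... | yes w∈p = w∈p
  ... | no w∉p = contradiction (w , w∈q , w∉p) noNew

module Inflationary {n} (f : Subset n → Subset n) (inflationary : ∀ p → p ⊆ f p) where

  fold-⊇ : ∀ p k → p ⊆ fold p f k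
  fold-⊇ p zero    = λ w∈p → w∈p
  fold-⊇ p (suc k) = inflationary (fold p f k) ∘ fold-⊇ p k

  fixed-or-large : ∀ p k → f (fold p f k) ≡ fold p f k ⊎ k ≤ ∣ fold p f k ∣
  fixed-or-large p zero = inj₂ z≤n
  fixed-or-large p (suc k) with fixed-or-large p k
  ... | inj₁ fixed = inj₁ (P.cong f fixed)
  ... | inj₂ large with ⊆⇒≡⊎⊂ (inflationary (fold p f k))
  ...   | inj₁ same  = inj₁ (P.cong f (P.sym same))
  ...   | inj₂ grows = inj₂ (≤-trans (s≤s large) (p⊂q⇒∣p∣<∣q∣ grows))

  fold-fixed : ∀ p → f (fold p f (suc n)) ≡ fold p f (suc n)
  fold-fixed p with fixed-or-large p (suc n)
  ... | inj₁ fixed = fixed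
  ... | inj₂ large = contradiction (≤-trans large (∣p∣≤n (fold p f (suc n)))) 1+n≰n

Adj⇒≢ : ∀ {n} (G : Graph n) {u v} → Adj G u v → u ≢ v
Adj⇒≢ G {v = v} uv P.refl = contradiction (P.trans (P.sym (adj-irr G v)) uv) λ ()

walk-weaken : ∀ {n} {G : Graph n} {W W′ : Fin n → Set} → (∀ w → W w → W′ w) →
              ∀ {a b} → Walk G W a b → Walk G W′ a b
walk-weaken W⊆W′ (stay w)          = stay (W⊆W′ _ w)
walk-weaken W⊆W′ (step w aw walk) = step (W⊆W′ _ w) aw (walk-weaken W⊆W′ walk)

component-of-smaller-deletion : ∀ {n} {G : Graph n} {M M′ S : Fin n → Set} →
  IsComponentOfDel G M S → (∀ v → M′ v → M v) →
  (∀ a b → S a → Adj G a b → M b → M′ b) → IsComponentOfDel G M′ S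
component-of-smaller-deletion (nonempty , avoids , walks , closed) M′⊆M boundary =
  nonempty ,
  (λ v Sv M′v → avoids v Sv (M′⊆M v M′v)) ,
  (λ a b Sa Sb → walk-weaken (λ w ¬Mw M′w → ¬Mw (M′⊆M w M′w)) (walks a b Sa Sb)) ,
  (λ a b Sa ¬M′b ab → closed a b Sa (λ Mb → ¬M′b (boundary a b Sa ab Mb)) ab)

-- Abstracts the component of G ∖ v containing the neighbour u of v: only these
-- properties of it are used.
record Branch {n} (G : Graph n) (v u : Fin n) : Set where
  field
    vertices : Subset n
    root     : u ∈ vertices
    cut      : v ∉ vertices
    closed   : ∀ {a w} → a ∈ vertices → Adj G a w → w ≢ v → w ∈ vertices
    attached : ∀ {b} → b ∈ vertices → Adj G v b → b ≡ u

-- Breadth-first search from u in G ∖ v; the invariant Rooted keeps a simple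
-- path back to u for every vertex found.
module BranchConstruction {n} (G : Graph n) (v u : Fin n) where

  Frontier : Subset n → Pred (Fin n) _
  Frontier S w = w ≢ v × ∃ λ a → a ∈ S × Adj G a w

  frontier? : ∀ S → Decidable (Frontier S)
  frontier? S w = ¬? (w ≟ v) ×-dec any? (λ a → (a ∈? S) ×-dec (adj G a w Bool.≟ true))

  grow : Subset n → Subset n
  grow S = S ∪ satisfying (frontier? S)

  open Inflationary grow (λ S → p⊆p∪q _)

  vertices : Subset n
  vertices = fold ⁅ u ⁆ grow (suc n)

  closed : ∀ {a w} → a ∈ vertices → Adj G a w → w ≢ v → w ∈ vertices
  closed {a} {w} a∈ aw w≢v = P.subst (w ∈_) (fold-fixed ⁅ u ⁆)
    (x∈p∪q⁺ (inj₂ (satisfying⁺ (frontier? vertices) (w≢v , a , a∈ , aw))))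

  SimplePathToRoot : Subset n → Fin n → Set
  SimplePathToRoot S w = ∃ λ rest → Unique (w ∷ rest) × Path G (w ∷ rest) ×
                         last (w ∷ rest) ≡ just u × All (_∈ S) (w ∷ rest)

  Rooted : Subset n → Set
  Rooted S = v ∉ S × (∀ {w} → w ∈ S → SimplePathToRoot S w)

  rooted-⁅u⁆ : u ≢ v → Rooted ⁅ u ⁆
  rooted-⁅u⁆ u≢v = x≢y⇒x∉⁅y⁆ (u≢v ∘ P.sym) , path
    where
    path : ∀ {w} → w ∈ ⁅ u ⁆ → SimplePathToRoot ⁅ u ⁆ w
    path w∈ with x∈⁅y⁆⇒x≡y u w∈
    ... | P.refl = [] , [] AllPairs.∷ AllPairs.[] , tt , P.refl , w∈ ∷ []

  rooted-grow : ∀ {S} → Rooted S → Rooted (grow S)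
  rooted-grow {S} (v∉S , path) = v∉grow , path′
    where
    v∉grow : v ∉ grow S
    v∉grow v∈ with x∈p∪q⁻ S _ v∈
    ... | inj₁ v∈S = v∉S v∈S
    ... | inj₂ v∈F with satisfying⁻ (frontier? S) v∈F
    ...   | v≢v , _ = v≢v P.refl

    weaken : ∀ {w} → SimplePathToRoot S w → SimplePathToRoot (grow S) w
    weaken (rest , unique , pa , ends , inS) =
      rest , unique , pa , ends , All.map (p⊆p∪q _) inS

    path′ : ∀ {w} → w ∈ grow S → SimplePathToRoot (grow S) w
    path′ {w} w∈ with x∈p∪q⁻ S _ w∈
    ... | inj₁ w∈S = weaken (path w∈S)
    ... | inj₂ w∈F with w ∈? S | satisfying⁻ (frontier? S) w∈F
    ...   | yes w∈S | _ = weaken (path w∈S)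
    ...   | no w∉S  | _ , a , a∈S , aw with path a∈S
    ...     | rest , unique , pa , ends , inS =
      a ∷ rest ,
      All.map (λ z∈S w≡z → w∉S (P.subst (_∈ S) (P.sym w≡z) z∈S)) inS AllPairs.∷ unique ,
      (P.trans (adj-sym G w a) aw , pa) , ends ,
      w∈ ∷ All.map (p⊆p∪q _) inS

  rooted : u ≢ v → ∀ k → Rooted (fold ⁅ u ⁆ grow k)
  rooted u≢v zero    = rooted-⁅u⁆ u≢v
  rooted u≢v (suc k) = rooted-grow (rooted u≢v k)

  root : u ∈ vertices
  root = fold-⊇ ⁅ u ⁆ (suc n) (x∈⁅x⁆ u)

  -- A second neighbour of v in the branch would close a cycle through v.
  attached : Acyclic G → Adj G u v → ∀ {b} → b ∈ vertices → Adj G v b → b ≡ u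
  attached acyclic uv {b} b∈ vb with rooted (Adj⇒≢ G uv) (suc n)
  ... | v∉ , path with path b∈
  ...   | [] , _ , _ , ends , _ = just-injective ends
  ...   | c ∷ rest , unique , pa , ends , inS =
    ⊥-elim (acyclic (v ∷ b ∷ c ∷ rest)
      (s≤s (s≤s (s≤s z≤n)) , v∉path AllPairs.∷ unique , (vb , pa) , u , ends , uv))
    where
    v∉path : All (v ≢_) (b ∷ c ∷ rest)
    v∉path = All.map (λ z∈ v≡z → v∉ (P.subst (_∈ vertices) (P.sym v≡z) z∈)) inS

branch : ∀ {n} {G : Graph n} {u v} → Acyclic G → Adj G u v → Branch G v u
branch {n} {G} {u} {v} acyclic uv = record
  { vertices = vertices
  ; root     = root
  ; cut      = proj₁ (rooted (Adj⇒≢ G uv) (suc n))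
  ; closed   = closed
  ; attached = attached acyclic uv
  }
  where open BranchConstruction G v u

module SpectralTheory (ℝ : RealField) where
  open RealField ℝ hiding (zero)
  open Spectral ℝ
  open SemiringSum semiring
    using (sum; sum-remove; sum-cong-≋; sum-replicate-zero; ∑-comm; *-distribˡ-sum; *-distribʳ-sum)
  open CommSemigroupProperties *-commutativeSemigroup using (x∙yz≈yx∙z)
  open CommSemigroupProperties +-commutativeSemigroup using (xy∙z≈xz∙y)
  open LoopProperties (GroupProperties.loop +-group) using (identityʳ-unique)
  open import Relation.Binary.Reasoning.Setoid setoid

  A-sym : ∀ {n} (G : Graph n) a b → A G a b ≡ A G b a
  A-sym G a b rewrite adj-sym G a b = P.refl

  A-of-Adj : ∀ {n} (G : Graph n) {a b} → Adj G a b → A G a b ≡ 1#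
  A-of-Adj G ab rewrite ab = P.refl

  A-of-¬Adj : ∀ {n} (G : Graph n) {a b} → ¬ Adj G a b → A G a b ≡ 0#
  A-of-¬Adj G {a} {b} ¬ab with adj G a b
  ... | true  = contradiction P.refl ¬ab
  ... | false = P.refl

  -- Σ[_] agrees with the library's sum only propositionally, so each
  -- summation law is transported along this equation.
  Σ≡sum : ∀ {m} (f : Fin m → Carrier) → Σ[ f ] ≡ sum f
  Σ≡sum {zero}  f = P.refl
  Σ≡sum {suc m} f = P.cong (f zero +_) (Σ≡sum (f ∘ suc))

  Σ-cong : ∀ {m} {f g : Fin m → Carrier} → (∀ i → f i ≈ g i) → Σ[ f ] ≈ Σ[ g ]
  Σ-cong {f = f} {g} f≈g = begin
    Σ[ f ]  ≡⟨ Σ≡sum f ⟩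
    sum f   ≈⟨ sum-cong-≋ f≈g ⟩
    sum g   ≡⟨ Σ≡sum g ⟨
    Σ[ g ]  ∎

  *-distribˡ-Σ : ∀ {m} a (f : Fin m → Carrier) → a * Σ[ f ] ≈ Σ[ (λ i → a * f i) ]
  *-distribˡ-Σ a f = begin
    a * Σ[ f ]              ≡⟨ P.cong (a *_) (Σ≡sum f) ⟩
    a * sum f               ≈⟨ *-distribˡ-sum a f ⟩
    sum (λ i → a * f i)     ≡⟨ Σ≡sum (λ i → a * f i) ⟨
    Σ[ (λ i → a * f i) ]    ∎

  *-distribʳ-Σ : ∀ {m} a (f : Fin m → Carrier) → Σ[ f ] * a ≈ Σ[ (λ i → f i * a) ]
  *-distribʳ-Σ a f = begin
    Σ[ f ] * a              ≡⟨ P.cong (_* a) (Σ≡sum f) ⟩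
    sum f * a               ≈⟨ *-distribʳ-sum a f ⟩
    sum (λ i → f i * a)     ≡⟨ Σ≡sum (λ i → f i * a) ⟨
    Σ[ (λ i → f i * a) ]    ∎

  Σ-comm : ∀ {m k} (F : Fin m → Fin k → Carrier) →
           Σ[ (λ i → Σ[ F i ]) ] ≈ Σ[ (λ j → Σ[ (λ i → F i j) ]) ]
  Σ-comm F = begin
    Σ[ (λ i → Σ[ F i ]) ]                ≈⟨ Σ-cong (λ i → reflexive (Σ≡sum (F i))) ⟩
    Σ[ (λ i → sum (F i)) ]               ≡⟨ Σ≡sum (λ i → sum (F i)) ⟩
    sum (λ i → sum (F i))                ≈⟨ ∑-comm F ⟩
    sum (λ j → sum (λ i → F i j))        ≡⟨ Σ≡sum (λ j → sum (λ i → F i j)) ⟨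
    Σ[ (λ j → sum (λ i → F i j)) ]       ≈⟨ Σ-cong (λ j → reflexive (Σ≡sum (λ i → F i j))) ⟨
    Σ[ (λ j → Σ[ (λ i → F i j) ]) ]      ∎

  Σ-remove : ∀ {m} (f : Fin (suc m) → Carrier) i → Σ[ f ] ≈ f i + Σ[ f ∘ punchIn i ]
  Σ-remove f i = begin
    Σ[ f ]                       ≡⟨ Σ≡sum f ⟩
    sum f                        ≈⟨ sum-remove f ⟩
    f i + sum (f ∘ punchIn i)    ≡⟨ P.cong (f i +_) (Σ≡sum (f ∘ punchIn i)) ⟨
    f i + Σ[ f ∘ punchIn i ]     ∎

  Σ-0 : ∀ {m} {f : Fin m → Carrier} → (∀ i → f i ≈ 0#) → Σ[ f ] ≈ 0#
  Σ-0 {m} f≈0 = trans (Σ-cong f≈0) (trans (reflexive (Σ≡sum zeros)) (sum-replicate-zero m))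
    where
    zeros : Fin m → Carrier
    zeros _ = 0#

  Σ-single : ∀ {m} (f : Fin m → Carrier) i → (∀ j → j ≢ i → f j ≈ 0#) → Σ[ f ] ≈ f i
  Σ-single {suc m} f i off = begin
    Σ[ f ]                    ≈⟨ Σ-remove f i ⟩
    f i + Σ[ f ∘ punchIn i ]  ≈⟨ +-congˡ (Σ-0 (λ j → off _ (punchInᵢ≢i i j))) ⟩
    f i + 0#                  ≈⟨ +-identityʳ (f i) ⟩
    f i                       ∎

  A*-of-Adj : ∀ {n} (G : Graph n) {a b} → Adj G a b → ∀ t → A G a b * t ≈ t
  A*-of-Adj G ab t = trans (*-congʳ (reflexive (A-of-Adj G ab))) (*-identityˡ t)

  A*-of-¬Adj : ∀ {n} (G : Graph n) {a b} → ¬ Adj G a b → ∀ t → A G a b * t ≈ 0#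
  A*-of-¬Adj G ¬ab t = trans (*-congʳ (reflexive (A-of-¬Adj G ¬ab))) (zeroˡ t)

  *-cancelʳ-nonzero : ∀ {a b} → a * b ≈ 0# → ¬ b ≈ 0# → a ≈ 0#
  *-cancelʳ-nonzero {a} {b} ab≈0 b≉0 with inverse b b≉0
  ... | b⁻¹ , bb⁻¹≈1 = begin
    a              ≈⟨ *-identityʳ a ⟨
    a * 1#         ≈⟨ *-congˡ bb⁻¹≈1 ⟨
    a * (b * b⁻¹)  ≈⟨ *-assoc a b b⁻¹ ⟨
    a * b * b⁻¹    ≈⟨ *-congʳ ab≈0 ⟩
    0# * b⁻¹       ≈⟨ zeroˡ b⁻¹ ⟩
    0#             ∎

  Mul-self-adjoint : ∀ {n} (G : Graph n) (y z : Fin n → Carrier) →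
    Σ[ (λ b → y b * Mul G z b) ] ≈ Σ[ (λ w → Mul G y w * z w) ]
  Mul-self-adjoint {n} G y z = begin
    Σ[ (λ b → y b * Mul G z b) ]                    ≈⟨ Σ-cong (λ b → *-distribˡ-Σ (y b) (row z b)) ⟩
    Σ[ (λ b → Σ[ (λ w → y b * row z b w) ]) ]       ≈⟨ Σ-comm (λ b w → y b * row z b w) ⟩
    Σ[ (λ w → Σ[ (λ b → y b * row z b w) ]) ]       ≈⟨ Σ-cong (λ w → Σ-cong (swap w)) ⟩
    Σ[ (λ w → Σ[ (λ b → row y w b * z w) ]) ]       ≈⟨ Σ-cong (λ w → *-distribʳ-Σ (z w) (row y w)) ⟨
    Σ[ (λ w → Mul G y w * z w) ]                    ∎
    where
    row : (Fin n → Carrier) → Fin n → Fin n → Carrier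
    row t b w = A G b w * t w

    swap : ∀ w b → y b * row z b w ≈ row y w b * z w
    swap w b = trans (x∙yz≈yx∙z (y b) (A G b w) (z w)) (*-congʳ (*-congʳ (reflexive (A-sym G b w))))

  -- c is the defect of z in the eigenvalue equation at v; self-adjointness of A
  -- makes every eigenvector y orthogonal to it.
  eigenvector-⊥-defect : ∀ {n} (G : Graph n) {λ' c} {y z : Fin n → Carrier} v →
    (∀ w → Mul G y w ≈ λ' * y w) →
    (∀ b → b ≢ v → Mul G z b ≈ λ' * z b) → Mul G z v ≈ λ' * z v + c →
    y v * c ≈ 0#
  eigenvector-⊥-defect {suc m} G {λ'} {c} {y} {z} v y-eigen z-off-v z-at-v =
    identityʳ-unique (Σ[ g ]) (y v * c) (trans (sym split) adjoint)
    where
    f g : Fin (suc m) → Carrier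
    f b = y b * Mul G z b
    g b = y b * (λ' * z b)

    adjoint : Σ[ f ] ≈ Σ[ g ]
    adjoint = begin
      Σ[ f ]                             ≈⟨ Mul-self-adjoint G y z ⟩
      Σ[ (λ w → Mul G y w * z w) ]       ≈⟨ Σ-cong (λ w → *-congʳ {z w} (y-eigen w)) ⟩
      Σ[ (λ w → λ' * y w * z w) ]        ≈⟨ Σ-cong (λ w → x∙yz≈yx∙z (y w) λ' (z w)) ⟨
      Σ[ g ]                             ∎

    split : Σ[ f ] ≈ Σ[ g ] + y v * c
    split = begin
      Σ[ f ]                                    ≈⟨ Σ-remove f v ⟩
      f v + Σ[ f ∘ punchIn v ]                  ≈⟨ +-cong (*-congˡ z-at-v) (Σ-cong off-v) ⟩
      y v * (λ' * z v + c) + Σ[ g ∘ punchIn v ] ≈⟨ +-congʳ (distribˡ (y v) (λ' * z v) c) ⟩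
      g v + y v * c + Σ[ g ∘ punchIn v ]        ≈⟨ xy∙z≈xz∙y (g v) (y v * c) _ ⟩
      g v + Σ[ g ∘ punchIn v ] + y v * c        ≈⟨ +-congʳ (Σ-remove g v) ⟨
      Σ[ g ] + y v * c                          ∎
      where
      off-v : ∀ j → f (punchIn v j) ≈ g (punchIn v j)
      off-v j = *-congˡ (z-off-v (punchIn v j) (punchInᵢ≢i v j))

  restrict : ∀ {n} → Subset n → (Fin n → Carrier) → Fin n → Carrier
  restrict S x w = if does (w ∈? S) then x w else 0#

  restrict-∈ : ∀ {n} {S : Subset n} {w} (x : Fin n → Carrier) → w ∈ S → restrict S x w ≈ x w
  restrict-∈ {S = S} {w} x w∈ with w ∈? S
  ... | yes _  = refl
  ... | no w∉ = contradiction w∈ w∉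

  restrict-∉ : ∀ {n} {S : Subset n} {w} (x : Fin n → Carrier) → w ∉ S → restrict S x w ≈ 0#
  restrict-∉ {S = S} {w} x w∉ with w ∈? S
  ... | yes w∈ = contradiction w∈ w∉
  ... | no _   = refl

  module BranchRestriction {n} (T : Graph n) {λ' : Carrier} {x : Fin n → Carrier}
    (x-eigen : ∀ w → Mul T x w ≈ λ' * x w) {u v} (uv : Adj T u v) (B : Branch T v u)
    (xv≈0 : x v ≈ 0#) where

    open Branch B

    z : Fin n → Carrier
    z = restrict vertices x

    term-inside : ∀ {b} → b ∈ vertices → ∀ w → A T b w * z w ≈ A T b w * x w
    term-inside {b} b∈ w with w ∈? vertices | w ≟ v
    ... | yes _  | _          = refl
    ... | no _   | yes P.refl = *-congˡ (sym xv≈0)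
    ... | no w∉  | no w≢v     = trans (A*-of-¬Adj T ¬bw 0#) (sym (A*-of-¬Adj T ¬bw (x w)))
      where
      ¬bw : ¬ Adj T b w
      ¬bw bw = w∉ (closed b∈ bw w≢v)

    term-outside : ∀ {b} → b ∉ vertices → b ≢ v → ∀ w → A T b w * z w ≈ 0#
    term-outside {b} b∉ b≢v w with w ∈? vertices
    ... | yes w∈ = A*-of-¬Adj T (λ bw → b∉ (closed w∈ (P.trans (adj-sym T w b) bw) b≢v)) (x w)
    ... | no _   = zeroʳ _

    term-at-cut : ∀ w → w ≢ u → A T v w * z w ≈ 0#
    term-at-cut w w≢u with w ∈? vertices
    ... | yes w∈ = A*-of-¬Adj T (λ vw → w≢u (attached w∈ vw)) (x w)
    ... | no _   = zeroʳ _

    z-off-cut : ∀ b → b ≢ v → Mul T z b ≈ λ' * z b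
    z-off-cut b b≢v with b ∈? vertices
    ... | yes b∈ = begin
      Mul T z b   ≈⟨ Σ-cong (term-inside b∈) ⟩
      Mul T x b   ≈⟨ x-eigen b ⟩
      λ' * x b    ∎
    ... | no b∉ = begin
      Mul T z b   ≈⟨ Σ-0 (term-outside b∉ b≢v) ⟩
      0#          ≈⟨ zeroʳ λ' ⟨
      λ' * 0#     ∎

    z-at-cut : Mul T z v ≈ λ' * z v + x u
    z-at-cut = begin
      Mul T z v          ≈⟨ Σ-single _ u term-at-cut ⟩
      A T v u * z u      ≈⟨ A*-of-Adj T (P.trans (adj-sym T v u) uv) (z u) ⟩
      z u                ≈⟨ restrict-∈ x root ⟩
      x u                ≈⟨ +-identityˡ (x u) ⟨
      0# + x u           ≈⟨ +-congʳ (trans (*-congˡ (restrict-∉ x cut)) (zeroʳ λ')) ⟨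
      λ' * z v + x u     ∎

  boundary-of-support⊆Nλ : ∀ {n} (T : Graph n) → Acyclic T → ∀ {λ' x} → IsEigenvector T λ' x →
    ∀ {u v} → Adj T u v → ¬ N T x u → N T x v → Nλ T λ' v
  boundary-of-support⊆Nλ T acyclic (_ , x-eigen) {v = v} uv xu≉0 xv≈0 y (_ , y-eigen) =
    *-cancelʳ-nonzero (eigenvector-⊥-defect T v y-eigen z-off-cut z-at-cut) xu≉0
    where open BranchRestriction T x-eigen uv (branch acyclic uv) xv≈0

mainTheorem7 : (ℝ : RealField) → let open Spectral ℝ in
    ∀ {n : ℕ} (T : Graph n) → IsTree T →
    ∀ (λ' : RealField.Carrier ℝ) (x : Fin n → RealField.Carrier ℝ) → IsEigenvector T λ' x →
    ∀ (S : Fin n → Set) →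
      IsComponentOfDel T (N T x) S → IsComponentOfDel T (Nλ T λ') S
mainTheorem7 ℝ T (_ , _ , acyclic) λ' x x-eigen S component@(_ , avoids , _) =
  component-of-smaller-deletion component
    (λ v Nλv → Nλv x x-eigen)
    (λ a b Sa ab xb≈0 → boundary-of-support⊆Nλ T acyclic x-eigen ab (avoids a Sa) xb≈0)
  where open SpectralTheory ℝ
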